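{- Let $L$ be a bounded lattice and $\neg$ a weak pseudocomplementation on $L$. Then the relation $\vartriangleleft$ of $\mathsf{FI}(L,\neg)$ is strongly pseudosymmetric.
   Context: A weak pseudocomplementation is an antitone unary operation ($a\le b\Rightarrow\neg b\le\neg a$) with $a\wedge\neg a=0$ and $a\le\neg\neg a$ for all $a$. $\mathsf{FI}(L,\neg)=(X,\vartriangleleft)$ where $X$ is the set of pairs $(F,I)$ with $F$ a filter of $L$, $I$ an ideal of $L$, $F\cap I=\varnothing$, and $\{\neg a\mid a\in F\}\subseteq I$; and $(F,I)\vartriangleleft(F',I')$ iff $I\cap F'=\varnothing$. A state $x$ pre-refines $y$ if for all $z$, $z\vartriangleleft x$ implies $z\vartriangleleft y$. $\vartriangleleft$ is strongly pseudosymmetric if for all $x$ and $y\vartriangleleft x$ there is $z\vartriangleleft y$ such that $z$ pre-refines $x$ and $x$ pre-refines $z$. -}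

module Defs where

open import Level using (Level; _⊔_; suc)
open import Data.Empty renaming (⊥ to Empty)
open import Data.Product using (Σ; _×_; _,_)
open import Relation.Unary using (Pred)
open import Relation.Binary.Lattice using (BoundedLattice)

module _ {c ℓ₁ ℓ₂ : Level} (L : BoundedLattice c ℓ₁ ℓ₂) where
  open BoundedLattice L

  record IsWeakPseudocomplementation (¬_ : Carrier → Carrier) : Set (c ⊔ ℓ₁ ⊔ ℓ₂) where
    field
      antitone : ∀ {a b} → a ≤ b → (¬ b) ≤ (¬ a)
      meet-neg : ∀ a → (a ∧ (¬ a)) ≈ ⊥
      double   : ∀ a → a ≤ (¬ (¬ a))

  Subset : Set (suc (c ⊔ ℓ₁ ⊔ ℓ₂))
  Subset = Pred Carrier (c ⊔ ℓ₁ ⊔ ℓ₂)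

  record IsFilter (F : Subset) : Set (c ⊔ ℓ₁ ⊔ ℓ₂) where
    field
      has-top : F ⊤
      up      : ∀ {a b} → a ≤ b → F a → F b
      meet    : ∀ {a b} → F a → F b → F (a ∧ b)

  record IsIdeal (I : Subset) : Set (c ⊔ ℓ₁ ⊔ ℓ₂) where
    field
      has-bot : I ⊥
      down    : ∀ {a b} → a ≤ b → I b → I a
      join    : ∀ {a b} → I a → I b → I (a ∨ b)

  Disjoint : Subset → Subset → Set (c ⊔ ℓ₁ ⊔ ℓ₂)
  Disjoint A B = ∀ a → A a → B a → Empty

  module FI (¬_ : Carrier → Carrier) where

    record State : Set (suc (c ⊔ ℓ₁ ⊔ ℓ₂)) where
      field
        F        : Subset
        I        : Subset
        isFilter : IsFilter F
        isIdeal  : IsIdeal I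
        disjoint : Disjoint F I
        negF⊆I   : ∀ a → F a → I (¬ a)

    _◁_ : State → State → Set (c ⊔ ℓ₁ ⊔ ℓ₂)
    x ◁ y = Disjoint (State.I x) (State.F y)

module _ {a r : Level} {X : Set a} where
  PreRefines : (X → X → Set r) → X → X → Set (a ⊔ r)
  PreRefines _◁_ x y = ∀ z → z ◁ x → z ◁ y

  StronglyPseudosymmetric : (X → X → Set r) → Set (a ⊔ r)
  StronglyPseudosymmetric _◁_ =
    ∀ x y → y ◁ x →
      Σ X (λ z → (z ◁ y) × (PreRefines _◁_ z x × PreRefines _◁_ x z))

-- Given y ◁ x, take z = (F, ↓¬[F]) where F is the filter of x and ↓¬[F] is the
-- down-closure of the negations of F.  Since z and x have the same filter, each
-- pre-refines the other.  For z ◁ y: if a ≤ ¬ f with f ∈ F and a in the filter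
-- of y, then ¬ a lies in the ideal of y, while f ≤ ¬ ¬ f ≤ ¬ a puts ¬ a in F,
-- contradicting y ◁ x.
module Submission where

open import Defs
open import Level using (Level)
open import Data.Empty using () renaming (⊥ to Empty)
open import Data.Product using (Σ; _×_; _,_)
open import Relation.Binary.Lattice using (BoundedLattice)

module _ {c ℓ₁ ℓ₂ : Level} (L : BoundedLattice c ℓ₁ ℓ₂) where
  open BoundedLattice L

  module _ {¬_ : Carrier → Carrier} where
    open FI L ¬_

    filter-⊇⇒preRefines : ∀ {x y} → (∀ a → State.F y a → State.F x a) →
                          PreRefines _◁_ x y
    filter-⊇⇒preRefines Fy⊆Fx w w◁x a Iwa Fya = w◁x a Iwa (Fy⊆Fx a Fya)

  module _ {¬_ : Carrier → Carrier} (wp : IsWeakPseudocomplementation L ¬_) where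
    open IsWeakPseudocomplementation wp

    ≤¬⇒∧≤⊥ : ∀ {a f} → a ≤ (¬ f) → (f ∧ a) ≤ ⊥
    ≤¬⇒∧≤⊥ {a} {f} a≤¬f =
      trans (∧-greatest (x∧y≤x f a) (trans (x∧y≤y f a) a≤¬f)) (reflexive (meet-neg f))

    ≤¬-swap : ∀ {a f} → a ≤ (¬ f) → f ≤ (¬ a)
    ≤¬-swap {a} {f} a≤¬f = trans (double f) (antitone a≤¬f)

    negationIdeal : Subset L → Subset L
    negationIdeal F a = Σ Carrier (λ f → F f × (a ≤ (¬ f)))

    module _ {F : Subset L} (isFilter : IsFilter L F) where
      open IsFilter isFilter

      negationIdeal-isIdeal : IsIdeal L (negationIdeal F)
      negationIdeal-isIdeal = record
        { has-bot = ⊤ , has-top , minimum (¬ ⊤)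
        ; down    = λ { a≤b (f , Ff , b≤¬f) → f , Ff , trans a≤b b≤¬f }
        ; join    = λ { (f , Ff , a≤¬f) (g , Fg , b≤¬g) →
            f ∧ g , meet Ff Fg ,
            ∨-least (trans a≤¬f (antitone (x∧y≤x f g)))
                    (trans b≤¬g (antitone (x∧y≤y f g))) }
        }

      negationIdeal-disjoint : (F ⊥ → Empty) → Disjoint L F (negationIdeal F)
      negationIdeal-disjoint F⊥-absurd a Fa (f , Ff , a≤¬f) =
        F⊥-absurd (up (≤¬⇒∧≤⊥ a≤¬f) (meet Ff Fa))

    open FI L ¬_

    negationState : State → State
    negationState x = record
      { F        = F
      ; I        = negationIdeal F
      ; isFilter = isFilter
      ; isIdeal  = negationIdeal-isIdeal isFilter
      ; disjoint = negationIdeal-disjoint isFilter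
                     (λ F⊥ → disjoint ⊥ F⊥ (IsIdeal.has-bot isIdeal))
      ; negF⊆I   = λ a Fa → a , Fa , refl
      }
      where open State x

    negationState-◁ : ∀ {x y} → y ◁ x → negationState x ◁ y
    negationState-◁ {x} {y} y◁x a (f , Fxf , a≤¬f) Fya =
      y◁x (¬ a) (State.negF⊆I y a Fya)
        (IsFilter.up (State.isFilter x) (≤¬-swap a≤¬f) Fxf)

proposition4p32 : ∀ {c ℓ₁ ℓ₂} (L : BoundedLattice c ℓ₁ ℓ₂)
    (¬_ : BoundedLattice.Carrier L → BoundedLattice.Carrier L) →
    IsWeakPseudocomplementation L ¬_ →
    StronglyPseudosymmetric (FI._◁_ L ¬_)
proposition4p32 L ¬_ wp x y y◁x =
  z ,
  negationState-◁ L wp {x} {y} y◁x ,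
  filter-⊇⇒preRefines L {¬_} {z} {x} (λ _ Fa → Fa) ,
  filter-⊇⇒preRefines L {¬_} {x} {z} (λ _ Fa → Fa)
  where
  z : FI.State L ¬_
  z = negationState L wp x
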